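{- Let $n\ge 3$, let $h$ be an affine Boolean function on $V_{n-1}$, let $b\in V_1$, let $g(x_1,\dots,x_{n-1})=\bigoplus_{i=1}^{n-1}x_i\oplus b$, and let $f$ be either $(h\,|\,h\oplus g)$ or $(h\,|\,l\oplus g)$ with $l(x)=h(x\oplus a)$ for some $a\in V_{n-1}$ of odd Hamming weight. If $f$ is balanced and satisfies the SAC, then $\sigma_f=2^{3n-2}$.
   Context: $V_m=\mathbb{Z}_2^m$. An affine function on $V_m$ has the form $\bigoplus_i c_ix_i\oplus c$. $(h\,|\,k)$ is the function $f$ on $V_n$ with $f(x',0)=h(x')$, $f(x',1)=k(x')$. Balanced means weight $2^{n-1}$. $\hat f(x)=(-1)^{f(x)}$, $\Delta_f(\alpha)=\sum_{x}\hat f(x)\hat f(x\oplus\alpha)$, $\sigma_f=\sum_{\alpha\in V_n}\Delta_f(\alpha)^2$. $f$ satisfies the SAC (strict avalanche criterion) if $\Delta_f(c)=0$ for every $c$ of Hamming weight $1$. -}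

module Defs where

open import Data.Bool using (Bool; true; false; _xor_; _∧_; if_then_else_)
open import Data.Nat using (ℕ; zero; suc; _+_)
open import Data.Integer using (ℤ; +_; -[1+_]; _*_) renaming (_+_ to _+ℤ_)
open import Data.List using (List; []; _∷_; _++_; map; foldr; [_])
open import Data.Vec using (Vec; []; _∷_; zipWith; init; last)

V : ℕ → Set
V m = Vec Bool m

BF : ℕ → Set
BF m = V m → Bool

allV : (m : ℕ) → List (V m)
allV zero = [ [] ]
allV (suc m) = map (false ∷_) (allV m) ++ map (true ∷_) (allV m)

sumℤ : List ℤ → ℤ
sumℤ = foldr _+ℤ_ (+ 0)

ΣV : (m : ℕ) → (V m → ℤ) → ℤ
ΣV m F = sumℤ (map F (allV m))

_⊕_ : {m : ℕ} → V m → V m → V m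
_⊕_ = zipWith _xor_

xorAll : {m : ℕ} → V m → Bool
xorAll [] = false
xorAll (x ∷ xs) = x xor xorAll xs

dot : {m : ℕ} → V m → V m → Bool
dot [] [] = false
dot (c ∷ cs) (x ∷ xs) = (c ∧ x) xor dot cs xs

hw : {m : ℕ} → V m → ℕ
hw [] = 0
hw (true ∷ xs) = suc (hw xs)
hw (false ∷ xs) = hw xs

wt : (m : ℕ) → BF m → ℕ
wt m f = foldr (λ x acc → (if f x then 1 else 0) + acc) 0 (allV m)

open import Relation.Binary.PropositionalEquality using (_≡_)
open import Data.Product using (Σ; _×_)

Affine : (m : ℕ) → BF m → Set
Affine m f = Σ (V m) λ c → Σ Bool λ c₀ → ∀ x → f x ≡ (dot c x xor c₀)

-- balanced: weight 2^{m-1}; for f on V_{suc m} this is 2^m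
open import Data.Nat using (_^_)
Balanced : (m : ℕ) → BF (suc m) → Set
Balanced m f = wt (suc m) f ≡ 2 ^ m

_⊕f_ : {m : ℕ} → BF m → BF m → BF m
(f ⊕f g) x = f x xor g x

-- concatenation (h | k): f(x',0) = h(x'), f(x',1) = k(x'); x_n is the last coordinate
_∣∣_ : {m : ℕ} → BF m → BF m → BF (suc m)
(h ∣∣ k) x = if last x then k (init x) else h (init x)

sgn : Bool → ℤ
sgn false = + 1
sgn true = -[1+ 0 ]

Δ : (m : ℕ) → BF m → V m → ℤ
Δ m f α = ΣV m (λ x → sgn (f x) * sgn (f (x ⊕ α)))

σ : (m : ℕ) → BF m → ℤ
σ m f = ΣV m (λ α → Δ m f α * Δ m f α)

SAC : (m : ℕ) → BF m → Set
SAC m f = (c : V m) → hw c ≡ 1 → Δ m f c ≡ + 0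

-- Write f = (α | α ⊕ g) with α affine with linear part c and g(y) = ⊕ yᵢ ⊕ b'
-- (the second family is of this form because α(y ⊕ a) = α(y) ⊕ c·a).  For a
-- concatenation, Δ_f(a,0) = Δ_α(a) + Δ_{α⊕g}(a) and Δ_f(a,1) is a sum of two
-- cross-correlations of α and α ⊕ g.  Here every derivative of α and of α ⊕ g
-- is constant, so Δ_f(a,0) = 2^m((-1)^{c·a} + (-1)^{c·a ⊕ wt a}), which is
-- ±2^{m+1} for the 2^{m-1} vectors a of even weight and 0 otherwise, while the
-- cross-derivatives are ⊕ yᵢ plus a constant, hence balanced, so Δ_f(a,1) = 0.
-- Thus σ_f = 2^{m-1} · 2^{2m+2} = 2^{3n-2}.
module Submission where

open import Defs
open import Data.Bool using (Bool; true; false; not; _xor_; _∧_; if_then_else_)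
open import Data.Bool.Properties
  using (xor-∧-commutativeRing; xor-identityʳ; not-distribˡ-xor; not-distribʳ-xor)
open import Data.Maybe using (just; nothing)
open import Data.Nat using (ℕ; zero; suc; _≤_; _^_; _*_; _∸_; _%_) renaming (_+_ to _+ℕ_)
import Data.Nat.Properties as ℕ
open import Data.Integer using (ℤ; +_) renaming (_+_ to _+ℤ_; _*_ to _*ℤ_)
import Data.Integer.Properties as ℤ
import Data.Integer.Tactic.RingSolver as ℤ-Solver
import Data.Nat.Tactic.RingSolver as ℕ-Solver
open import Data.List using (List; []; _∷_; _++_; map)
import Data.List.Properties as List
open import Data.Vec using ([]; _∷_; _∷ʳ_; init; last)
import Data.Vec.Properties as Vec
open import Data.Sum using (_⊎_; inj₁; inj₂)
open import Data.Product using (Σ; _×_; _,_)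
open import Function using (_∘_)
open import Level using (0ℓ)
open import Relation.Binary.PropositionalEquality
  using (_≡_; _≗_; refl; sym; trans; cong; cong₂; module ≡-Reasoning)
import Tactic.RingSolver as RingSolver
open import Tactic.RingSolver.Core.AlmostCommutativeRing
  using (AlmostCommutativeRing; fromCommutativeRing)

open ≡-Reasoning

xorRing : AlmostCommutativeRing 0ℓ 0ℓ
xorRing = fromCommutativeRing xor-∧-commutativeRing
  (λ { false → just refl ; true → nothing })

sumℤ-++ : (xs ys : List ℤ) → sumℤ (xs ++ ys) ≡ sumℤ xs +ℤ sumℤ ys
sumℤ-++ []       ys = sym (ℤ.+-identityˡ _)
sumℤ-++ (x ∷ xs) ys = trans (cong (x +ℤ_) (sumℤ-++ xs ys)) (sym (ℤ.+-assoc x _ _))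

ΣV-cong : ∀ m {F G : V m → ℤ} → F ≗ G → ΣV m F ≡ ΣV m G
ΣV-cong m F≗G = cong sumℤ (List.map-cong F≗G (allV m))

ΣV-∷ : ∀ m (F : V (suc m) → ℤ) →
  ΣV (suc m) F ≡ ΣV m (F ∘ (false ∷_)) +ℤ ΣV m (F ∘ (true ∷_))
ΣV-∷ m F = begin
  sumℤ (map F (ys₀ ++ ys₁))                  ≡⟨ cong sumℤ (List.map-++ F ys₀ ys₁) ⟩
  sumℤ (map F ys₀ ++ map F ys₁)              ≡⟨ sumℤ-++ (map F ys₀) (map F ys₁) ⟩
  sumℤ (map F ys₀) +ℤ sumℤ (map F ys₁)
    ≡⟨ cong₂ _+ℤ_ (cong sumℤ (List.map-∘ (allV m))) (cong sumℤ (List.map-∘ (allV m))) ⟨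
  ΣV m (F ∘ (false ∷_)) +ℤ ΣV m (F ∘ (true ∷_)) ∎
  where
  ys₀ ys₁ : List (V (suc m))
  ys₀ = map (false ∷_) (allV m)
  ys₁ = map (true ∷_) (allV m)

ΣV-∷ʳ : ∀ m (F : V (suc m) → ℤ) →
  ΣV (suc m) F ≡ ΣV m (λ y → F (y ∷ʳ false)) +ℤ ΣV m (λ y → F (y ∷ʳ true))
ΣV-∷ʳ zero    F = cong (_+ℤ (F (true ∷ []) +ℤ + 0)) (sym (ℤ.+-identityʳ (F (false ∷ []))))
ΣV-∷ʳ (suc m) F = begin
  ΣV (suc (suc m)) F
    ≡⟨ ΣV-∷ (suc m) F ⟩
  ΣV (suc m) (F ∘ (false ∷_)) +ℤ ΣV (suc m) (F ∘ (true ∷_))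
    ≡⟨ cong₂ _+ℤ_ (ΣV-∷ʳ m _) (ΣV-∷ʳ m _) ⟩
  (part false false +ℤ part false true) +ℤ (part true false +ℤ part true true)
    ≡⟨ interchange (part false false) (part false true) (part true false) (part true true) ⟩
  (part false false +ℤ part true false) +ℤ (part false true +ℤ part true true)
    ≡⟨ cong₂ _+ℤ_ (ΣV-∷ m _) (ΣV-∷ m _) ⟨
  ΣV (suc m) (λ y → F (y ∷ʳ false)) +ℤ ΣV (suc m) (λ y → F (y ∷ʳ true)) ∎
  where
  part : Bool → Bool → ℤ
  part s t = ΣV m (λ y → F (s ∷ (y ∷ʳ t)))
  interchange : ∀ a b c d → (a +ℤ b) +ℤ (c +ℤ d) ≡ (a +ℤ c) +ℤ (b +ℤ d)
  interchange = ℤ-Solver.solve-∀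

2^suc-* : ∀ m k → + (2 ^ suc m) *ℤ k ≡ + (2 ^ m) *ℤ k +ℤ + (2 ^ m) *ℤ k
2^suc-* m k = begin
  + (2 ^ m +ℕ (2 ^ m +ℕ 0)) *ℤ k
    ≡⟨ cong (λ e → + (2 ^ m +ℕ e) *ℤ k) (ℕ.+-identityʳ _) ⟩
  + (2 ^ m +ℕ 2 ^ m) *ℤ k
    ≡⟨ cong (_*ℤ k) (ℤ.pos-+ (2 ^ m) (2 ^ m)) ⟩
  (+ (2 ^ m) +ℤ + (2 ^ m)) *ℤ k
    ≡⟨ ℤ.*-distribʳ-+ k (+ (2 ^ m)) (+ (2 ^ m)) ⟩
  + (2 ^ m) *ℤ k +ℤ + (2 ^ m) *ℤ k ∎

ΣV-const : ∀ m k → ΣV m (λ _ → k) ≡ + (2 ^ m) *ℤ k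
ΣV-const zero    k = trans (ℤ.+-identityʳ k) (sym (ℤ.*-identityˡ k))
ΣV-const (suc m) k = begin
  ΣV (suc m) (λ _ → k)                    ≡⟨ ΣV-∷ m _ ⟩
  ΣV m (λ _ → k) +ℤ ΣV m (λ _ → k)        ≡⟨ cong₂ _+ℤ_ (ΣV-const m k) (ΣV-const m k) ⟩
  + (2 ^ m) *ℤ k +ℤ + (2 ^ m) *ℤ k        ≡⟨ 2^suc-* m k ⟨
  + (2 ^ suc m) *ℤ k                      ∎

ΣV-xorAll : ∀ m p (G : Bool → ℤ) →
  ΣV (suc m) (λ y → G (xorAll y xor p)) ≡ + (2 ^ m) *ℤ (G false +ℤ G true)
ΣV-xorAll zero false G = solve (G false) (G true)
  where
  solve : ∀ u v → u +ℤ (v +ℤ + 0) ≡ + 1 *ℤ (u +ℤ v)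
  solve = ℤ-Solver.solve-∀
ΣV-xorAll zero true G = solve (G false) (G true)
  where
  solve : ∀ u v → v +ℤ (u +ℤ + 0) ≡ + 1 *ℤ (u +ℤ v)
  solve = ℤ-Solver.solve-∀
ΣV-xorAll (suc m) p G = begin
  ΣV (suc (suc m)) (λ y → G (xorAll y xor p))
    ≡⟨ ΣV-∷ (suc m) _ ⟩
  ΣV (suc m) (λ y → G (xorAll y xor p)) +ℤ ΣV (suc m) (λ y → G (not (xorAll y) xor p))
    ≡⟨ cong (ΣV (suc m) (λ y → G (xorAll y xor p)) +ℤ_) (ΣV-cong (suc m) (cong G ∘ not-xor)) ⟩
  ΣV (suc m) (λ y → G (xorAll y xor p)) +ℤ ΣV (suc m) (λ y → G (xorAll y xor not p))
    ≡⟨ cong₂ _+ℤ_ (ΣV-xorAll m p G) (ΣV-xorAll m (not p) G) ⟩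
  + (2 ^ m) *ℤ (G false +ℤ G true) +ℤ + (2 ^ m) *ℤ (G false +ℤ G true)
    ≡⟨ 2^suc-* m _ ⟨
  + (2 ^ suc m) *ℤ (G false +ℤ G true) ∎
  where
  not-xor : ∀ y → not (xorAll y) xor p ≡ xorAll y xor not p
  not-xor y = trans (sym (not-distribˡ-xor (xorAll y) p)) (not-distribʳ-xor (xorAll y) p)

sgn-xor : ∀ p q → sgn p *ℤ sgn q ≡ sgn (p xor q)
sgn-xor false false = refl
sgn-xor false true  = refl
sgn-xor true  false = refl
sgn-xor true  true  = refl

ΣV-sgn-xorAll : ∀ m p → ΣV (suc m) (λ y → sgn (xorAll y xor p)) ≡ + 0
ΣV-sgn-xorAll m p = trans (ΣV-xorAll m p sgn) (ℤ.*-zeroʳ (+ (2 ^ m)))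

⊕-∷ʳ : ∀ {m} (y a : V m) t s → (y ∷ʳ t) ⊕ (a ∷ʳ s) ≡ (y ⊕ a) ∷ʳ (t xor s)
⊕-∷ʳ []       []       t s = refl
⊕-∷ʳ (y ∷ ys) (a ∷ as) t s = cong ((y xor a) ∷_) (⊕-∷ʳ ys as t s)

xorAll-⊕ : ∀ {m} (y a : V m) → xorAll (y ⊕ a) ≡ xorAll y xor xorAll a
xorAll-⊕ []       []       = refl
xorAll-⊕ (y ∷ ys) (a ∷ as) =
  trans (cong ((y xor a) xor_) (xorAll-⊕ ys as)) (regroup y a (xorAll ys) (xorAll as))
  where
  regroup : ∀ y a u v → (y xor a) xor (u xor v) ≡ (y xor u) xor (a xor v)
  regroup = RingSolver.solve-∀ xorRing

dot-⊕ : ∀ {m} (c y a : V m) → dot c (y ⊕ a) ≡ dot c y xor dot c a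
dot-⊕ []       []       []       = refl
dot-⊕ (c ∷ cs) (y ∷ ys) (a ∷ as) =
  trans (cong ((c ∧ (y xor a)) xor_) (dot-⊕ cs ys as)) (regroup c y a (dot cs ys) (dot cs as))
  where
  regroup : ∀ c y a u v → (c ∧ (y xor a)) xor (u xor v) ≡ ((c ∧ y) xor u) xor ((c ∧ a) xor v)
  regroup = RingSolver.solve-∀ xorRing

-- Δ m f is definitionally corr m f f.
corr : (m : ℕ) → BF m → BF m → V m → ℤ
corr m h k α = ΣV m (λ x → sgn (h x) *ℤ sgn (k (x ⊕ α)))

corr-derivative : ∀ m (h k : BF m) α (D : BF m) →
  (∀ x → h x xor k (x ⊕ α) ≡ D x) → corr m h k α ≡ ΣV m (sgn ∘ D)
corr-derivative m h k α D eq = ΣV-cong m (λ x → trans (sgn-xor (h x) (k (x ⊕ α))) (cong sgn (eq x)))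

Δ-cong : ∀ m {f g : BF m} → f ≗ g → ∀ α → Δ m f α ≡ Δ m g α
Δ-cong m f≗g α = ΣV-cong m (λ x → cong₂ (λ u v → sgn u *ℤ sgn v) (f≗g x) (f≗g (x ⊕ α)))

σ-cong : ∀ m {f g : BF m} → f ≗ g → σ m f ≡ σ m g
σ-cong m f≗g = ΣV-cong m (λ α → cong₂ _*ℤ_ (Δ-cong m f≗g α) (Δ-cong m f≗g α))

∣∣-cong : ∀ {m} {h h′ k k′ : BF m} → h ≗ h′ → k ≗ k′ → (h ∣∣ k) ≗ (h′ ∣∣ k′)
∣∣-cong h≗h′ k≗k′ x = cong₂ (if_then_else_ (last x)) (k≗k′ (init x)) (h≗h′ (init x))

module _ {m : ℕ} (h k : BF m) where

  ∣∣-∷ʳ : ∀ y t → (h ∣∣ k) (y ∷ʳ t) ≡ (if t then k y else h y)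
  ∣∣-∷ʳ y t rewrite Vec.last-∷ʳ t y | Vec.init-∷ʳ t y = refl

  private
    Δ-∣∣-split : ∀ a s → Δ (suc m) (h ∣∣ k) (a ∷ʳ s) ≡
      corr m h (λ z → if s then k z else h z) a +ℤ corr m k (λ z → if not s then k z else h z) a
    Δ-∣∣-split a s =
      trans (ΣV-∷ʳ m _) (cong₂ _+ℤ_ (ΣV-cong m (summand false)) (ΣV-cong m (summand true)))
      where
      summand : ∀ t y → sgn ((h ∣∣ k) (y ∷ʳ t)) *ℤ sgn ((h ∣∣ k) ((y ∷ʳ t) ⊕ (a ∷ʳ s)))
                      ≡ sgn (if t then k y else h y) *ℤ sgn (if t xor s then k (y ⊕ a) else h (y ⊕ a))
      summand t y = cong₂ (λ u v → sgn u *ℤ sgn v) (∣∣-∷ʳ y t)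
        (trans (cong (h ∣∣ k) (⊕-∷ʳ y a t s)) (∣∣-∷ʳ (y ⊕ a) (t xor s)))

  Δ-∣∣-∷ʳfalse : ∀ a → Δ (suc m) (h ∣∣ k) (a ∷ʳ false) ≡ Δ m h a +ℤ Δ m k a
  Δ-∣∣-∷ʳfalse a = Δ-∣∣-split a false

  Δ-∣∣-∷ʳtrue : ∀ a → Δ (suc m) (h ∣∣ k) (a ∷ʳ true) ≡ corr m h k a +ℤ corr m k h a
  Δ-∣∣-∷ʳtrue a = Δ-∣∣-split a true

affine : ∀ {m} → V m → Bool → BF m
affine c c₀ y = dot c y xor c₀

parity : ∀ {m} → Bool → BF m
parity b y = xorAll y xor b

sgn-sum-square : ∀ d e →
  (sgn d +ℤ sgn (d xor e)) *ℤ (sgn d +ℤ sgn (d xor e)) ≡ (if e then + 0 else + 4)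
sgn-sum-square false false = refl
sgn-sum-square false true  = refl
sgn-sum-square true  false = refl
sgn-sum-square true  true  = refl

square-sgn-sum : ∀ P d e →
  (P *ℤ sgn d +ℤ P *ℤ sgn (d xor e)) *ℤ (P *ℤ sgn d +ℤ P *ℤ sgn (d xor e))
    ≡ P *ℤ P *ℤ (if e then + 0 else + 4)
square-sgn-sum P d e =
  trans (factor P (sgn d) (sgn (d xor e))) (cong (P *ℤ P *ℤ_) (sgn-sum-square d e))
  where
  factor : ∀ P u v → (P *ℤ u +ℤ P *ℤ v) *ℤ (P *ℤ u +ℤ P *ℤ v) ≡ P *ℤ P *ℤ ((u +ℤ v) *ℤ (u +ℤ v))
  factor = ℤ-Solver.solve-∀

σ-value : ∀ k → let P = + (2 ^ suc k) in
  + (2 ^ k) *ℤ (P *ℤ P *ℤ + 4 +ℤ P *ℤ P *ℤ + 0) +ℤ P *ℤ + 0 ≡ + (2 ^ (3 * suc (suc k) ∸ 2))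
σ-value k = begin
  Q *ℤ (P *ℤ P *ℤ + 4 +ℤ P *ℤ P *ℤ + 0) +ℤ P *ℤ + 0  ≡⟨ drop-zeros Q P ⟩
  Q *ℤ (P *ℤ P *ℤ + 4)                                ≡⟨ to-ℕ ⟨
  + (E * (2 * E * (2 * E) * 4))                       ≡⟨ cong +_ (regroup E) ⟩
  + (E * (2 * (2 * E) * (2 * (2 * E))))
    ≡⟨ cong +_ (cong (E *_) (cong (2 ^ (2 +ℕ k) *_) (cong (2 ^_) (ℕ.+-identityʳ (2 +ℕ k))))) ⟨
  + (2 ^ k * (2 ^ (2 +ℕ k) * 2 ^ (2 +ℕ k +ℕ 0)))
    ≡⟨ cong +_ (cong (E *_) (ℕ.^-distribˡ-+-* 2 (2 +ℕ k) (2 +ℕ k +ℕ 0))) ⟨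
  + (2 ^ k * 2 ^ (2 +ℕ k +ℕ (2 +ℕ k +ℕ 0)))          ≡⟨ cong +_ (ℕ.^-distribˡ-+-* 2 k _) ⟨
  + (2 ^ (3 * suc (suc k) ∸ 2))                       ∎
  where
  E = 2 ^ k
  Q = + E
  P = + (2 ^ suc k)
  drop-zeros : ∀ Q P → Q *ℤ (P *ℤ P *ℤ + 4 +ℤ P *ℤ P *ℤ + 0) +ℤ P *ℤ + 0 ≡ Q *ℤ (P *ℤ P *ℤ + 4)
  drop-zeros = ℤ-Solver.solve-∀
  regroup : ∀ E → E * (2 * E * (2 * E) * 4) ≡ E * (2 * (2 * E) * (2 * (2 * E)))
  regroup = ℕ-Solver.solve-∀
  to-ℕ : + (E * (2 * E * (2 * E) * 4)) ≡ Q *ℤ (P *ℤ P *ℤ + 4)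
  to-ℕ = begin
    + (E * (2 * E * (2 * E) * 4))    ≡⟨ ℤ.pos-* E _ ⟩
    Q *ℤ + (2 * E * (2 * E) * 4)     ≡⟨ cong (Q *ℤ_) (ℤ.pos-* (2 * E * (2 * E)) 4) ⟩
    Q *ℤ (+ (2 * E * (2 * E)) *ℤ + 4) ≡⟨ cong (λ x → Q *ℤ (x *ℤ + 4)) (ℤ.pos-* (2 * E) (2 * E)) ⟩
    Q *ℤ (P *ℤ P *ℤ + 4)             ∎

module AffineConcatenation {m : ℕ} (c : V (suc m)) (c₀ b : Bool) where

  α β : BF (suc m)
  α = affine c c₀
  β = α ⊕f parity b

  private
    α-derivative : ∀ a y → α y xor α (y ⊕ a) ≡ dot c a
    α-derivative a y rewrite dot-⊕ c y a = regroup (dot c y) (dot c a) c₀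
      where
      regroup : ∀ u v c₀ → (u xor c₀) xor ((u xor v) xor c₀) ≡ v
      regroup = RingSolver.solve-∀ xorRing

    β-derivative : ∀ a y → β y xor β (y ⊕ a) ≡ dot c a xor xorAll a
    β-derivative a y rewrite dot-⊕ c y a | xorAll-⊕ y a =
      regroup (dot c y) (dot c a) c₀ (xorAll y) (xorAll a) b
      where
      regroup : ∀ u v c₀ w z b →
        ((u xor c₀) xor (w xor b)) xor (((u xor v) xor c₀) xor ((w xor z) xor b)) ≡ v xor z
      regroup = RingSolver.solve-∀ xorRing

    αβ-derivative : ∀ a y → α y xor β (y ⊕ a) ≡ xorAll y xor ((dot c a xor xorAll a) xor b)
    αβ-derivative a y rewrite dot-⊕ c y a | xorAll-⊕ y a =
      regroup (dot c y) (dot c a) c₀ (xorAll y) (xorAll a) b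
      where
      regroup : ∀ u v c₀ w z b →
        (u xor c₀) xor (((u xor v) xor c₀) xor ((w xor z) xor b)) ≡ w xor ((v xor z) xor b)
      regroup = RingSolver.solve-∀ xorRing

    βα-derivative : ∀ a y → β y xor α (y ⊕ a) ≡ xorAll y xor (b xor dot c a)
    βα-derivative a y rewrite dot-⊕ c y a = regroup (dot c y) (dot c a) c₀ (xorAll y) b
      where
      regroup : ∀ u v c₀ w b → ((u xor c₀) xor (w xor b)) xor ((u xor v) xor c₀) ≡ w xor (b xor v)
      regroup = RingSolver.solve-∀ xorRing

  P : ℤ
  P = + (2 ^ suc m)

  Δ-∷ʳfalse : ∀ a → Δ (suc (suc m)) (α ∣∣ β) (a ∷ʳ false)
                    ≡ P *ℤ sgn (dot c a) +ℤ P *ℤ sgn (dot c a xor xorAll a)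
  Δ-∷ʳfalse a = trans (Δ-∣∣-∷ʳfalse α β a) (cong₂ _+ℤ_
    (trans (corr-derivative _ α α a _ (α-derivative a)) (ΣV-const (suc m) _))
    (trans (corr-derivative _ β β a _ (β-derivative a)) (ΣV-const (suc m) _)))

  Δ-∷ʳtrue : ∀ a → Δ (suc (suc m)) (α ∣∣ β) (a ∷ʳ true) ≡ + 0
  Δ-∷ʳtrue a = trans (Δ-∣∣-∷ʳtrue α β a) (cong₂ _+ℤ_
    (trans (corr-derivative _ α β a _ (αβ-derivative a)) (ΣV-sgn-xorAll m _))
    (trans (corr-derivative _ β α a _ (βα-derivative a)) (ΣV-sgn-xorAll m _)))

  σ-∣∣ : σ (suc (suc m)) (α ∣∣ β) ≡ + (2 ^ (3 * suc (suc m) ∸ 2))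
  σ-∣∣ = begin
    σ (suc (suc m)) (α ∣∣ β)
      ≡⟨ ΣV-∷ʳ (suc m) _ ⟩
    ΣV (suc m) (λ a → Δ² (a ∷ʳ false)) +ℤ ΣV (suc m) (λ a → Δ² (a ∷ʳ true))
      ≡⟨ cong₂ _+ℤ_ (ΣV-cong (suc m) Δ²-∷ʳfalse) (ΣV-cong (suc m) Δ²-∷ʳtrue) ⟩
    ΣV (suc m) (λ a → G (xorAll a xor false)) +ℤ ΣV (suc m) (λ _ → + 0)
      ≡⟨ cong₂ _+ℤ_ (ΣV-xorAll m false G) (ΣV-const (suc m) (+ 0)) ⟩
    + (2 ^ m) *ℤ (G false +ℤ G true) +ℤ P *ℤ + 0
      ≡⟨ σ-value m ⟩
    + (2 ^ (3 * suc (suc m) ∸ 2)) ∎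
    where
    Δ² : V (suc (suc m)) → ℤ
    Δ² α′ = Δ (suc (suc m)) (α ∣∣ β) α′ *ℤ Δ (suc (suc m)) (α ∣∣ β) α′
    G : Bool → ℤ
    G e = P *ℤ P *ℤ (if e then + 0 else + 4)
    Δ²-∷ʳfalse : ∀ a → Δ² (a ∷ʳ false) ≡ G (xorAll a xor false)
    Δ²-∷ʳfalse a = begin
      Δ² (a ∷ʳ false)
        ≡⟨ trans (cong₂ _*ℤ_ (Δ-∷ʳfalse a) (Δ-∷ʳfalse a)) (square-sgn-sum P (dot c a) (xorAll a)) ⟩
      G (xorAll a)                      ≡⟨ cong G (xor-identityʳ (xorAll a)) ⟨
      G (xorAll a xor false)            ∎
    Δ²-∷ʳtrue : ∀ a → Δ² (a ∷ʳ true) ≡ + 0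
    Δ²-∷ʳtrue a = cong₂ _*ℤ_ (Δ-∷ʳtrue a) (Δ-∷ʳtrue a)

translate-⊕f-parity : ∀ {m} (h : BF m) c c₀ a b → h ≗ affine c c₀ →
  (λ y → h (y ⊕ a)) ⊕f parity b ≗ affine c c₀ ⊕f parity (dot c a xor b)
translate-⊕f-parity h c c₀ a b h≗α y = begin
  h (y ⊕ a) xor parity b y
    ≡⟨ cong (_xor parity b y) (h≗α (y ⊕ a)) ⟩
  (dot c (y ⊕ a) xor c₀) xor parity b y
    ≡⟨ cong (λ d → (d xor c₀) xor parity b y) (dot-⊕ c y a) ⟩
  ((dot c y xor dot c a) xor c₀) xor (xorAll y xor b)
    ≡⟨ regroup (dot c y) (dot c a) c₀ (xorAll y) b ⟩
  (dot c y xor c₀) xor (xorAll y xor (dot c a xor b)) ∎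
  where
  regroup : ∀ u v c₀ w b → ((u xor v) xor c₀) xor (w xor b) ≡ (u xor c₀) xor (w xor (v xor b))
  regroup = RingSolver.solve-∀ xorRing

corollary2 : (m : ℕ) → 2 ≤ m → (h : BF m) → Affine m h → (b : Bool) → (f : BF (suc m)) →
    ((∀ x → f x ≡ (h ∣∣ (h ⊕f (λ y → xorAll y xor b))) x)
      ⊎ Σ (V m) (λ a → (hw a % 2 ≡ 1) ×
          (∀ x → f x ≡ (h ∣∣ ((λ y → h (y ⊕ a)) ⊕f (λ y → xorAll y xor b))) x))) →
    Balanced m f → SAC (suc m) f →
    σ (suc m) f ≡ + (2 ^ (3 * suc m ∸ 2))
corollary2 (suc m) _ h (c , c₀ , h≗α) b f (inj₁ f≗) _ _ =
  trans (σ-cong _ (λ x → trans (f≗ x) (∣∣-cong h≗α right-half x)))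
        (AffineConcatenation.σ-∣∣ c c₀ b)
  where
  right-half : h ⊕f parity b ≗ affine c c₀ ⊕f parity b
  right-half y = cong (_xor parity b y) (h≗α y)
corollary2 (suc m) _ h (c , c₀ , h≗α) b f (inj₂ (a , _ , f≗)) _ _ =
  trans (σ-cong _ (λ x → trans (f≗ x) (∣∣-cong h≗α (translate-⊕f-parity h c c₀ a b h≗α) x)))
        (AffineConcatenation.σ-∣∣ c c₀ (dot c a xor b))
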